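{- Let $k,\ell\ge1$, $\lambda\in\mathrm P^k_\ell$ and $x\in[\ell]$. Then $x\in[b_\lambda]$ if and only if $k-\lambda_x+x<\ell$.
   Context: $[b]=\{1,\dots,b\}$. $\mathrm P^k_\ell$: $k$-bounded partitions with at most $\ell$ parts, as $\ell$-tuples $\lambda_1\ge\cdots\ge\lambda_\ell\ge0$, $\lambda_1\le k$. $\Delta^+_\ell=\{(i,j):1\le i<j\le\ell\}$ with partial order $(a,b)\le(c,d)$ iff $a\ge c$ and $b\le d$; a root ideal is an upper order ideal of it. For $\lambda\in\mathrm P^k_\ell$, $\Delta^k(\lambda)=\{(i,j)\in\Delta^+_\ell:k-\lambda_i+i<j\}$. The bottom $b_\lambda$ of $\Delta^k(\lambda)$ is the row index $b$ such that $(b,p)\in\Delta^k(\lambda)$ for some $p$ and $(b+1,q)\notin\Delta^k(\lambda)$ for all $q$ (and $b_\lambda=0$ if $\Delta^k(\lambda)=\emptyset$). -}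

module Defs where

open import Data.Nat using (ℕ; zero; suc; _+_; _∸_; _≤_; _<_; _<?_)
open import Data.Fin using (Fin; fromℕ<)
open import Data.Product using (_×_; ∃)
open import Relation.Nullary using (¬_; yes; no)
open import Relation.Binary.PropositionalEquality using (_≡_)

-- A k-bounded partition with at most ℓ parts, as an ℓ-tuple
-- (λ₁,…,λ_ℓ) (stored 0-based as Fin ℓ → ℕ) with
-- λ₁ ≥ ⋯ ≥ λ_ℓ ≥ 0 and λ₁ ≤ k.
record BoundedPartition (k ℓ : ℕ) : Set where
  field
    part     : Fin ℓ → ℕ
    weaklyDecreasing : ∀ (i j : Fin ℓ) → Data.Fin._≤_ i j → part j ≤ part i
    bounded  : ∀ (i : Fin ℓ) → part i ≤ k
open BoundedPartition public

-- 1-indexed access: λ at i for i ∈ [ℓ] (value 0 outside [ℓ], never used there).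
_at_ : ∀ {k ℓ} → BoundedPartition k ℓ → ℕ → ℕ
_at_ λ′ zero = 0
_at_ {ℓ = ℓ} λ′ (suc i) with i <? ℓ
... | yes p = part λ′ (fromℕ< p)
... | no _  = 0

InPositiveRoots : ℕ → ℕ → ℕ → Set
InPositiveRoots ℓ i j = (1 ≤ i) × (i < j) × (j ≤ ℓ)

InΔ : ∀ (k ℓ : ℕ) → BoundedPartition k ℓ → ℕ → ℕ → Set
InΔ k ℓ λ′ i j = InPositiveRoots ℓ i j × (k ∸ (λ′ at i) + i < j)

ΔEmpty : ∀ (k ℓ : ℕ) → BoundedPartition k ℓ → Set
ΔEmpty k ℓ λ′ = ∀ i j → ¬ InΔ k ℓ λ′ i j

data IsBottom (k ℓ : ℕ) (λ′ : BoundedPartition k ℓ) (b : ℕ) : Set where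
  empty    : ΔEmpty k ℓ λ′ → b ≡ 0 → IsBottom k ℓ λ′ b
  nonempty : ∃ (λ p → InΔ k ℓ λ′ b p) → (∀ q → ¬ InΔ k ℓ λ′ (suc b) q) →
             IsBottom k ℓ λ′ b

{-# OPTIONS --safe #-}
-- Put f(i) = k − λ_i + i. Row i of Δᵏ(λ) is nonempty iff f(i) < ℓ, since then
-- (i , ℓ) is a root of it; and as λ is weakly decreasing, f is monotone, so the
-- nonempty rows form an initial segment [1 .. b] of [ℓ]. Its last row b is the
-- bottom b_λ, and x ≤ b_λ says exactly that row x is nonempty.
module Submission where

open import Defs
open import Data.Nat using (ℕ; zero; suc; _+_; _∸_; _≤_; _<_; _≤?_; _<?_; z≤n; s≤s)
open import Data.Nat.Properties
  using (≤-refl; ≤-trans; <-≤-trans; ≤-<-trans; <⇒≤; <-irrefl; <-irrelevant; m≤n+m;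
         +-mono-≤; ∸-monoʳ-≤; m≤n⇒m<n∨m≡n; ≰⇒>; module ≤-Reasoning)
import Data.Fin as Fin
open import Data.Fin using (fromℕ<)
open import Data.Fin.Properties using (toℕ-fromℕ<)
open import Data.Product using (_×_; ∃; _,_)
open import Data.Sum using (_⊎_; inj₁; inj₂)
open import Function.Bundles using (_⇔_; mk⇔; Equivalence)
open import Function.Construct.Composition using (_⇔-∘_)
open import Function.Construct.Symmetry using (⇔-sym)
open import Relation.Nullary using (¬_; yes; no; contradiction)
open import Relation.Nullary.Decidable using (map)
open import Relation.Unary using (Pred; Decidable)
open import Relation.Binary.PropositionalEquality using (_≡_; refl; cong; sym; subst₂)

module _ {p} {P : Pred ℕ p} where

  none⊎last : Decidable P → ∀ n → ¬ P n →
              (∀ i → i ≤ n → ¬ P i) ⊎ ∃ λ b → P b × ¬ P (suc b)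
  none⊎last P? zero ¬P0 = inj₁ λ { zero _ → ¬P0 }
  none⊎last P? (suc n) ¬Pn+1 with P? n
  ... | yes Pn = inj₂ (n , Pn , ¬Pn+1)
  ... | no ¬Pn with none⊎last P? n ¬Pn
  ...   | inj₂ last = inj₂ last
  ...   | inj₁ none = inj₁ λ i i≤n+1 → extend i (m≤n⇒m<n∨m≡n i≤n+1)
    where
      extend : ∀ i → i < suc n ⊎ i ≡ suc n → ¬ P i
      extend i (inj₁ (s≤s i≤n)) = none i i≤n
      extend _ (inj₂ refl)      = ¬Pn+1

  ≤last⇔ : (∀ {x y} → 1 ≤ x → x ≤ y → P y → P x) →
           ∀ {b x} → P b → ¬ P (suc b) → 1 ≤ x → (x ≤ b ⇔ P x)
  ≤last⇔ P-down {b} {x} Pb ¬Pb+1 1≤x = mk⇔ (λ x≤b → P-down 1≤x x≤b Pb) beforeLast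
    where
      beforeLast : P x → x ≤ b
      beforeLast Px with x ≤? b
      ... | yes x≤b = x≤b
      ... | no  x≰b = contradiction (P-down (s≤s z≤n) (≰⇒> x≰b) Px) ¬Pb+1

module _ {k ℓ : ℕ} (λ′ : BoundedPartition k ℓ) where

  at-suc : ∀ {i} (i<ℓ : i < ℓ) → λ′ at suc i ≡ part λ′ (fromℕ< i<ℓ)
  at-suc {i} i<ℓ with i <? ℓ
  ... | yes i<ℓ′ = cong (λ q → part λ′ (fromℕ< q)) (<-irrelevant i<ℓ′ i<ℓ)
  ... | no  i≮ℓ  = contradiction i<ℓ i≮ℓ

  at-antitone : ∀ {x y} → 1 ≤ x → x ≤ y → y ≤ ℓ → λ′ at y ≤ λ′ at x
  at-antitone {suc i} {suc j} _ (s≤s i≤j) j<ℓ = begin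
    λ′ at suc j               ≡⟨ at-suc j<ℓ ⟩
    part λ′ (fromℕ< j<ℓ)      ≤⟨ weaklyDecreasing λ′ _ _ fromℕ<i≤fromℕ<j ⟩
    part λ′ (fromℕ< i<ℓ)      ≡⟨ at-suc i<ℓ ⟨
    λ′ at suc i               ∎
    where
      open ≤-Reasoning
      i<ℓ : i < ℓ
      i<ℓ = <-≤-trans (s≤s i≤j) j<ℓ
      fromℕ<i≤fromℕ<j : fromℕ< i<ℓ Fin.≤ fromℕ< j<ℓ
      fromℕ<i≤fromℕ<j = subst₂ _≤_ (sym (toℕ-fromℕ< i<ℓ)) (sym (toℕ-fromℕ< j<ℓ)) i≤j

  rowThreshold : ℕ → ℕ
  rowThreshold i = k ∸ (λ′ at i) + i

  rowThreshold-mono-≤ : ∀ {x y} → 1 ≤ x → x ≤ y → y ≤ ℓ → rowThreshold x ≤ rowThreshold y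
  rowThreshold-mono-≤ 1≤x x≤y y≤ℓ = +-mono-≤ (∸-monoʳ-≤ k (at-antitone 1≤x x≤y y≤ℓ)) x≤y

  NonEmptyRow : Pred ℕ _
  NonEmptyRow i = ∃ (InΔ k ℓ λ′ i)

  nonEmptyRow⇒<ℓ : ∀ {i} → NonEmptyRow i → i < ℓ
  nonEmptyRow⇒<ℓ (_ , (_ , i<j , j≤ℓ) , _) = <-≤-trans i<j j≤ℓ

  nonEmptyRow⇔ : ∀ {i} → 1 ≤ i → NonEmptyRow i ⇔ rowThreshold i < ℓ
  nonEmptyRow⇔ {i} 1≤i = mk⇔ (λ { (j , (_ , _ , j≤ℓ) , f<j) → <-≤-trans f<j j≤ℓ }) lastColumn
    where
      lastColumn : rowThreshold i < ℓ → NonEmptyRow i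
      lastColumn f<ℓ = ℓ , (1≤i , ≤-<-trans (m≤n+m i _) f<ℓ , ≤-refl) , f<ℓ

  nonEmptyRow? : Decidable NonEmptyRow
  nonEmptyRow? i with 1 ≤? i
  ... | yes 1≤i = map (⇔-sym (nonEmptyRow⇔ 1≤i)) (rowThreshold i <? ℓ)
  ... | no  1≰i = no λ { (_ , (1≤i , _) , _) → 1≰i 1≤i }

  nonEmptyRow-downward : ∀ {x y} → 1 ≤ x → x ≤ y → NonEmptyRow y → NonEmptyRow x
  nonEmptyRow-downward 1≤x x≤y row-y =
    Equivalence.from (nonEmptyRow⇔ 1≤x)
      (≤-<-trans (rowThreshold-mono-≤ 1≤x x≤y (<⇒≤ (nonEmptyRow⇒<ℓ row-y)))
                 (Equivalence.to (nonEmptyRow⇔ (≤-trans 1≤x x≤y)) row-y))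

  bottom-exists : ∃ (IsBottom k ℓ λ′)
  bottom-exists with none⊎last nonEmptyRow? ℓ (λ row-ℓ → <-irrefl refl (nonEmptyRow⇒<ℓ row-ℓ))
  ... | inj₁ none = 0 , empty (λ i j d → none i (<⇒≤ (nonEmptyRow⇒<ℓ (j , d))) (j , d)) refl
  ... | inj₂ (b , row-b , ¬row-b+1) = b , nonempty row-b (λ q d → ¬row-b+1 (q , d))

  ≤bottom⇔nonEmptyRow : ∀ {b x} → IsBottom k ℓ λ′ b → 1 ≤ x → (x ≤ b ⇔ NonEmptyRow x)
  ≤bottom⇔nonEmptyRow (empty none refl) 1≤x =
    mk⇔ (λ x≤0 → contradiction (<-≤-trans 1≤x x≤0) λ ()) λ (j , d) → contradiction d (none _ j)
  ≤bottom⇔nonEmptyRow (nonempty row-b ¬row-b+1) =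
    ≤last⇔ nonEmptyRow-downward row-b λ (q , d) → ¬row-b+1 q d

lemma4p2 : ∀ (k ℓ : ℕ) → 1 ≤ k → 1 ≤ ℓ → (λ′ : BoundedPartition k ℓ) →
    ∃ (λ b → IsBottom k ℓ λ′ b)
    × (∀ (b : ℕ) → IsBottom k ℓ λ′ b →
    ∀ (x : ℕ) → 1 ≤ x → x ≤ ℓ →
    ((x ≤ b) ⇔ (k ∸ (λ′ at x) + x < ℓ)))
lemma4p2 k ℓ _ _ λ′ =
  bottom-exists λ′ ,
  λ b isBottom x 1≤x _ → nonEmptyRow⇔ λ′ 1≤x ⇔-∘ ≤bottom⇔nonEmptyRow λ′ isBottom 1≤x
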